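{- Let $\mathcal{A}\subseteq\mathbb{F}^{n_1}\otimes\mathbb{F}^{n_2}$ and $\mathcal{B}\subseteq\mathbb{F}^{m_1}\otimes\mathbb{F}^{m_2}$ be subspaces of matrices, and suppose all matrices in $\mathcal{A}$ are diagonal. Then $\operatorname{min-rank}(\mathcal{A}\otimes\mathcal{B})\geq\operatorname{min-rank}(\mathcal{A})\cdot\operatorname{min-rank}(\mathcal{B})$.
   Context: $\mathcal{A}\otimes\mathcal{B}$ is the subspace of (Kronecker product) matrices spanned by all $A\otimes B$ with $A\in\mathcal{A}$, $B\in\mathcal{B}$. $\operatorname{min-rank}$ of a matrix subspace is the smallest rank of a nonzero element. A matrix is diagonal if its support is contained in $\{(i,i)\}$. -}

module Defs where

open import Level using (Level; _⊔_)
open import Data.Nat using (ℕ; zero; suc)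
open import Data.Fin using (Fin; zero; suc; toℕ; quotient; remainder)
open import Data.Product using (Σ; Σ-syntax; _×_; _,_; ∃)
open import Relation.Nullary using (¬_)
open import Relation.Binary.PropositionalEquality using (_≢_)
open import Algebra.Bundles using (CommutativeRing)

record Field (c ℓ : Level) : Set (Level.suc (c ⊔ ℓ)) where
  field
    commutativeRing : CommutativeRing c ℓ
  open CommutativeRing commutativeRing public
  field
    0≉1     : ¬ (0# ≈ 1#)
    inverse : ∀ x → ¬ (x ≈ 0#) → Σ Carrier (λ y → x * y ≈ 1#)

module FieldDefs {c ℓ : Level} (F : Field c ℓ) where
  open Field F using (Carrier; _≈_; _+_; _*_; 0#; 1#)

  Matrix : ℕ → ℕ → Set c
  Matrix m n = Fin m → Fin n → Carrier

  ∑ : (k : ℕ) → (Fin k → Carrier) → Carrier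
  ∑ zero    f = 0#
  ∑ (suc k) f = f zero + ∑ k (λ i → f (suc i))

  _≈ᴹ_ : ∀ {m n} → Matrix m n → Matrix m n → Set ℓ
  M ≈ᴹ N = ∀ i j → M i j ≈ N i j

  0ᴹ : ∀ {m n} → Matrix m n
  0ᴹ i j = 0#

  _+ᴹ_ : ∀ {m n} → Matrix m n → Matrix m n → Matrix m n
  (M +ᴹ N) i j = M i j + N i j

  _·ᴹ_ : ∀ {m n} → Carrier → Matrix m n → Matrix m n
  (x ·ᴹ M) i j = x * M i j

  NonZero : ∀ {m n} → Matrix m n → Set ℓ
  NonZero M = ¬ (M ≈ᴹ 0ᴹ)

  Diagonal : ∀ {m n} → Matrix m n → Set ℓ
  Diagonal M = ∀ i j → toℕ i ≢ toℕ j → M i j ≈ 0#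

  RankLE : ∀ {m n} → Matrix m n → ℕ → Set (c ⊔ ℓ)
  RankLE {m} {n} M r =
    Σ (Matrix m r) λ U → Σ (Matrix r n) λ V →
      ∀ i j → M i j ≈ ∑ r (λ k → U i k * V k j)

  record IsSubspace {p} {m n} (S : Matrix m n → Set p) : Set (c ⊔ ℓ ⊔ p) where
    field
      resp  : ∀ {M N} → M ≈ᴹ N → S M → S N
      zero∈ : S 0ᴹ
      +∈    : ∀ {M N} → S M → S N → S (M +ᴹ N)
      ·∈    : ∀ x {M} → S M → S (x ·ᴹ M)

  IsMinRank : ∀ {p} {m n} → (Matrix m n → Set p) → ℕ → Set (c ⊔ ℓ ⊔ p)
  IsMinRank {m = m} {n} S k =
    (Σ (Matrix m n) λ M → S M × NonZero M × RankLE M k) ×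
    (∀ M → S M → NonZero M → ∀ r → RankLE M r → k Data.Nat.≤ r)

  -- Kronecker product: (A ⊗ B)[(i,k),(j,l)] = A[i,j] B[k,l],
  -- with row/column index (i,k) encoded as i * m₁ + k (Data.Fin.combine)
  kron : ∀ {n₁ n₂ m₁ m₂} → Matrix n₁ n₂ → Matrix m₁ m₂ →
         Matrix (n₁ Data.Nat.* m₁) (n₂ Data.Nat.* m₂)
  kron {n₁} {n₂} {m₁} {m₂} A B r s =
    A (quotient {n₁} m₁ r) (quotient {n₂} m₂ s) *
    B (remainder {n₁} m₁ r) (remainder {n₂} m₂ s)

  _⊗ˢ_ : ∀ {p q} {n₁ n₂ m₁ m₂} →
         (Matrix n₁ n₂ → Set p) → (Matrix m₁ m₂ → Set q) →
         Matrix (n₁ Data.Nat.* m₁) (n₂ Data.Nat.* m₂) → Set (c ⊔ ℓ ⊔ p ⊔ q)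
  _⊗ˢ_ {n₁ = n₁} {n₂} {m₁} {m₂} 𝒜 ℬ M =
    Σ ℕ λ k → Σ (Fin k → Carrier) λ cs →
    Σ (Fin k → Matrix n₁ n₂) λ As → Σ (Fin k → Matrix m₁ m₂) λ Bs →
      (∀ i → 𝒜 (As i)) × (∀ i → ℬ (Bs i)) ×
      (∀ r s → M r s ≈ ∑ k (λ i → cs i * kron (As i) (Bs i) r s))

-- View M ∈ 𝒜 ⊗ ℬ as an n₁ × n₂ array of m₁ × m₂ blocks M[i,j]. Every block lies in ℬ, and for
-- fixed (k,l) the slice (M[i,j]ₖₗ)ᵢⱼ lies in 𝒜, hence is diagonal; so blocks off the diagonal
-- vanish. A nonzero entry of M gives a nonzero slice, which has a independent columns j₁ … jₐ
-- (otherwise its rank would be below a); their nonzero entries sit on the diagonal, at rows iₜ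
-- with iₜ = jₜ. The blocks M[iₜ,jₜ] are nonzero elements of ℬ with b independent columns each,
-- and as they occupy distinct block rows and block columns, these a·b columns of M are
-- independent. A factorisation M = U V through Fʳ then forces a·b ≤ r (Steinitz).
-- Equality in F is not decidable, so the existence claims are made in the double-negation
-- monad; the conclusion a * b ≤ r is decidable, hence stable.
module Submission where

open import Defs
open import Level using (Level; _⊔_)
open import Data.Nat using (ℕ; _*_; _≤_)

open import Data.Nat as ℕ using (zero; suc; _<_; s≤s; z≤n)
import Data.Nat.Properties as ℕ
open import Data.Fin as Fin using (Fin; toℕ; combine; quotient; remainder; punchIn; punchOut; _↑ˡ_; _↑ʳ_)
import Data.Fin.Properties as Fin
open import Data.Vec.Functional using (Vector; _∷_; map)
open import Data.Product using (Σ-syntax; ∃; ∃₂; _×_; _,_; proj₁; proj₂)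
open import Data.Sum using (_⊎_; inj₁; inj₂)
open import Function using (_∘_; const)
open import Relation.Nullary using (¬_; yes; no)
open import Relation.Nullary.Negation using (contradiction; negated-stable; ¬¬-map)
open import Relation.Nullary.Decidable using (decidable-stable; ¬¬-excluded-middle)
open import Relation.Binary.PropositionalEquality as ≡ using (_≡_; _≢_)

infixl 1 _>>=_

_>>=_ : ∀ {a b} {A : Set a} {B : Set b} → ¬ ¬ A → (A → ¬ ¬ B) → ¬ ¬ B
m >>= f = negated-stable (¬¬-map f m)

return : ∀ {a} {A : Set a} → A → ¬ ¬ A
return = contradiction

¬¬-∀-Fin : ∀ {p} n {P : Fin n → Set p} → (∀ t → ¬ ¬ P t) → ¬ ¬ (∀ t → P t)
¬¬-∀-Fin zero    h = return λ ()
¬¬-∀-Fin (suc n) h = do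
  p₀ ← h Fin.zero
  ps ← ¬¬-∀-Fin n (h ∘ Fin.suc)
  return λ { Fin.zero → p₀ ; (Fin.suc t) → ps t }

¬∀⇒¬¬∃¬ : ∀ {p} n {P : Fin n → Set p} → ¬ (∀ t → P t) → ¬ ¬ ∃ λ t → ¬ P t
¬∀⇒¬¬∃¬ n ¬∀P ¬∃ = ¬¬-∀-Fin n (λ t ¬Pt → ¬∃ (t , ¬Pt)) ¬∀P

module MatrixSpaces {c ℓ} (F : Field c ℓ) where
  open Field F hiding (zero) renaming (_*_ to _·_)
  open FieldDefs F
  open import Algebra.Properties.Semiring.Sum semiring
  open import Algebra.Properties.Ring ring using (-1*x≈-x; -‿distribˡ-*; -‿distribʳ-*)
  open import Algebra.Properties.Group +-group using (inverseˡ-unique; ε⁻¹≈ε)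
  open import Relation.Binary.Reasoning.Setoid setoid

  1≉0 : 1# ≉ 0#
  1≉0 = 0≉1 ∘ sym

  ∑≡sum : ∀ n (f : Vector Carrier n) → ∑ n f ≡ sum f
  ∑≡sum zero    f = ≡.refl
  ∑≡sum (suc n) f = ≡.cong (f Fin.zero +_) (∑≡sum n (f ∘ Fin.suc))

  sum-zero : ∀ {n} {f : Vector Carrier n} → (∀ t → f t ≈ 0#) → sum f ≈ 0#
  sum-zero {n} f≈0 = trans (sum-cong-≋ f≈0) (sum-replicate-zero n)

  sum-single : ∀ {n} (f : Vector Carrier n) t₀ → (∀ t → t ≢ t₀ → f t ≈ 0#) → sum f ≈ f t₀
  sum-single {suc n} f t₀ f≈0 = begin
    sum f                                 ≈⟨ sum-remove {i = t₀} f ⟩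
    f t₀ + sum (λ t → f (punchIn t₀ t))   ≈⟨ +-congˡ (sum-zero (λ t → f≈0 _ (Fin.punchInᵢ≢i t₀ t))) ⟩
    f t₀ + 0#                             ≈⟨ +-identityʳ _ ⟩
    f t₀                                  ∎

  sum-neg : ∀ {n} (f : Vector Carrier n) → sum (λ t → - f t) ≈ - sum f
  sum-neg f = begin
    sum (λ t → - f t)        ≈⟨ sum-cong-≋ (λ t → sym (-1*x≈-x (f t))) ⟩
    sum (map (- 1# ·_) f)    ≈⟨ *-distribˡ-sum (- 1#) f ⟨
    - 1# · sum f             ≈⟨ -1*x≈-x _ ⟩
    - sum f                  ∎

  sum-↑ : ∀ m {n} (f : Vector Carrier (m ℕ.+ n)) →
          sum f ≈ sum (λ i → f (i ↑ˡ n)) + sum (λ j → f (m ↑ʳ j))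
  sum-↑ zero    f = sym (+-identityˡ _)
  sum-↑ (suc m) f = trans (+-congˡ (sum-↑ m (f ∘ Fin.suc))) (sym (+-assoc _ _ _))

  sum-combine : ∀ a b (f : Vector Carrier (a * b)) →
                sum f ≈ sum (λ t → sum (λ u → f (combine {a} {b} t u)))
  sum-combine zero    b f = refl
  sum-combine (suc a) b f = trans (sum-↑ b f) (+-congˡ (sum-combine a b (f ∘ (b ↑ʳ_))))

  linComb : ∀ {s m} → Vector Carrier s → (Fin s → Vector Carrier m) → Vector Carrier m
  linComb cs w i = sum (λ t → cs t · w t i)

  Dependent : ∀ {s m} → (Fin s → Vector Carrier m) → Set (c ⊔ ℓ)
  Dependent {s} w = Σ[ cs ∈ Vector Carrier s ] (∃ λ t → cs t ≉ 0#) × (∀ i → linComb cs w i ≈ 0#)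

  Independent : ∀ {s m} → (Fin s → Vector Carrier m) → Set (c ⊔ ℓ)
  Independent w = ¬ Dependent w

  InSpan : ∀ {s m} → (Fin s → Vector Carrier m) → Vector Carrier m → Set (c ⊔ ℓ)
  InSpan {s} w v = Σ[ cs ∈ Vector Carrier s ] (∀ i → v i ≈ linComb cs w i)

  linComb-scale : ∀ {s m} x cs (w : Fin s → Vector Carrier m) i →
                  linComb (λ t → x · cs t) w i ≈ x · linComb cs w i
  linComb-scale x cs w i = begin
    sum (λ t → (x · cs t) · w t i)          ≈⟨ sum-cong-≋ (λ t → *-assoc x (cs t) (w t i)) ⟩
    sum (map (x ·_) (λ t → cs t · w t i))   ≈⟨ *-distribˡ-sum x (λ t → cs t · w t i) ⟨
    x · linComb cs w i                      ∎

  linComb-sub : ∀ {s m} cs ds (w : Fin s → Vector Carrier m) i →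
                linComb (λ t → cs t - ds t) w i ≈ linComb cs w i - linComb ds w i
  linComb-sub cs ds w i = begin
    sum (λ t → (cs t - ds t) · w t i)
      ≈⟨ sum-cong-≋ (λ t → trans (distribʳ (w t i) (cs t) (- ds t)) (+-congˡ (sym (-‿distribˡ-* (ds t) (w t i))))) ⟩
    sum (λ t → cs t · w t i + - (ds t · w t i))
      ≈⟨ ∑-distrib-+ (λ t → cs t · w t i) (λ t → - (ds t · w t i)) ⟩
    linComb cs w i + sum (λ t → - (ds t · w t i))
      ≈⟨ +-congˡ (sum-neg (λ t → ds t · w t i)) ⟩
    linComb cs w i - linComb ds w i
      ∎

  linComb-sub-multiple : ∀ {s m} d (l : Vector Carrier s) (w : Fin s → Vector Carrier m) (v : Vector Carrier m) i →
    linComb d (λ u j → w u j - l u · v j) i ≈ linComb d w i - sum (λ u → d u · l u) · v i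
  linComb-sub-multiple d l w v i = begin
    sum (λ u → d u · (w u i - l u · v i))
      ≈⟨ sum-cong-≋ (λ u → trans (distribˡ (d u) (w u i) (- (l u · v i)))
                          (+-congˡ (trans (sym (-‿distribʳ-* (d u) (l u · v i)))
                                          (-‿cong (sym (*-assoc (d u) (l u) (v i))))))) ⟩
    sum (λ u → d u · w u i + - ((d u · l u) · v i))
      ≈⟨ ∑-distrib-+ (λ u → d u · w u i) (λ u → - ((d u · l u) · v i)) ⟩
    linComb d w i + sum (λ u → - ((d u · l u) · v i))
      ≈⟨ +-congˡ (sum-neg (λ u → (d u · l u) · v i)) ⟩
    linComb d w i - sum (λ u → (d u · l u) · v i)
      ≈⟨ +-congˡ (-‿cong (*-distribʳ-sum (v i) (λ u → d u · l u))) ⟨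
    linComb d w i - sum (λ u → d u · l u) · v i
      ∎

  basis : ∀ {s} → Fin s → Vector Carrier s
  basis t u with t Fin.≟ u
  ... | yes _ = 1#
  ... | no  _ = 0#

  basis-self : ∀ {s} (t : Fin s) → basis t t ≈ 1#
  basis-self t with t Fin.≟ t
  ... | yes _   = refl
  ... | no  t≢t = contradiction ≡.refl t≢t

  basis-other : ∀ {s} {t u : Fin s} → t ≢ u → basis t u ≈ 0#
  basis-other {t = t} {u} t≢u with t Fin.≟ u
  ... | yes t≡u = contradiction t≡u t≢u
  ... | no  _   = refl

  linComb-basis : ∀ {s m} t (w : Fin s → Vector Carrier m) i → linComb (basis t) w i ≈ w t i
  linComb-basis t w i = begin
    linComb (basis t) w i   ≈⟨ sum-single _ t (λ u u≢t → trans (*-congʳ (basis-other (u≢t ∘ ≡.sym))) (zeroˡ _)) ⟩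
    basis t t · w t i       ≈⟨ trans (*-congʳ (basis-self t)) (*-identityˡ _) ⟩
    w t i                   ∎

  inSpan-member : ∀ {s m} (w : Fin s → Vector Carrier m) t → InSpan w (w t)
  inSpan-member w t = basis t , λ i → sym (linComb-basis t w i)

  inSpan-∷ : ∀ {s m} (w : Fin (suc s) → Vector Carrier m) {v} → InSpan (w ∘ Fin.suc) v → InSpan w v
  inSpan-∷ w (cs , v≈) = 0# ∷ cs , λ i → trans (v≈ i) (sym (trans (+-congʳ (zeroˡ _)) (+-identityˡ _)))

  dependent-of-zero : ∀ {s m} (w : Fin s → Vector Carrier m) t → (∀ i → w t i ≈ 0#) → Dependent w
  dependent-of-zero w t wt≈0 =
    basis t , (t , λ e → 1≉0 (trans (sym (basis-self t)) e)) , λ i → trans (linComb-basis t w i) (wt≈0 i)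

  independent⇒nonzero : ∀ {s m} {w : Fin s → Vector Carrier m} → Independent w → ∀ t → ¬ (∀ i → w t i ≈ 0#)
  independent⇒nonzero {w = w} ind t = ind ∘ dependent-of-zero w t

  independent⇒injective : ∀ {s m} {w : Fin s → Vector Carrier m} → Independent w →
                          ∀ {t t′} → (∀ i → w t i ≈ w t′ i) → t ≡ t′
  independent⇒injective {w = w} ind {t} {t′} wt≈wt′ = decidable-stable (t Fin.≟ t′) λ t≢t′ →
    ind ((λ u → basis t u - basis t′ u) , (t , coefficient≉0 t≢t′) , λ i → begin
      linComb (λ u → basis t u - basis t′ u) w i   ≈⟨ linComb-sub (basis t) (basis t′) w i ⟩
      linComb (basis t) w i - linComb (basis t′) w i  ≈⟨ +-cong (linComb-basis t w i) (-‿cong (linComb-basis t′ w i)) ⟩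
      w t i - w t′ i                                 ≈⟨ +-congʳ (wt≈wt′ i) ⟩
      w t′ i - w t′ i                                ≈⟨ -‿inverseʳ _ ⟩
      0#                                             ∎)
    where
    coefficient≉0 : t ≢ t′ → basis t t - basis t′ t ≉ 0#
    coefficient≉0 t≢t′ e = 1≉0 (begin
      1#                      ≈⟨ +-identityʳ 1# ⟨
      1# + 0#                 ≈⟨ +-congˡ ε⁻¹≈ε ⟨
      1# - 0#                 ≈⟨ +-cong (basis-self t) (-‿cong (basis-other (t≢t′ ∘ ≡.sym))) ⟨
      basis t t - basis t′ t  ≈⟨ e ⟩
      0#                      ∎)

  independent-∷ : ∀ {s m} (w : Fin (suc s) → Vector Carrier m) →
                  Independent (w ∘ Fin.suc) → ¬ InSpan (w ∘ Fin.suc) (w Fin.zero) → Independent w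
  independent-∷ w ind ∉span (cs , (t , cs-t≉0) , rel) = ¬¬-excluded-middle λ
    { (yes cs₀≈0) → ind (cs ∘ Fin.suc , tail-nonzero cs₀≈0 t cs-t≉0 , λ i → begin
        linComb (cs ∘ Fin.suc) (w ∘ Fin.suc) i   ≈⟨ +-identityˡ _ ⟨
        0# + linComb (cs ∘ Fin.suc) (w ∘ Fin.suc) i   ≈⟨ +-congʳ (trans (*-congʳ cs₀≈0) (zeroˡ _)) ⟨
        linComb cs w i                                ≈⟨ rel i ⟩
        0#                                            ∎)
    ; (no cs₀≉0) → ∉span (w₀-inSpan cs₀≉0) }
    where
    tail-nonzero : cs Fin.zero ≈ 0# → ∀ t → cs t ≉ 0# → ∃ λ t → cs (Fin.suc t) ≉ 0#
    tail-nonzero cs₀≈0 Fin.zero    cs₀≉0 = contradiction cs₀≈0 cs₀≉0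
    tail-nonzero cs₀≈0 (Fin.suc t) cs-t≉0 = t , cs-t≉0
    w₀-inSpan : cs Fin.zero ≉ 0# → InSpan (w ∘ Fin.suc) (w Fin.zero)
    w₀-inSpan cs₀≉0 = (λ t → - y · cs (Fin.suc t)) , λ i → begin
      w Fin.zero i                                    ≈⟨ *-identityˡ _ ⟨
      1# · w Fin.zero i                               ≈⟨ *-congʳ (trans (sym cs₀y≈1) (*-comm _ _)) ⟩
      (y · cs Fin.zero) · w Fin.zero i                ≈⟨ *-assoc _ _ _ ⟩
      y · (cs Fin.zero · w Fin.zero i)                ≈⟨ *-congˡ (inverseˡ-unique _ _ (rel i)) ⟩
      y · (- linComb (cs ∘ Fin.suc) (w ∘ Fin.suc) i)  ≈⟨ trans (sym (-‿distribʳ-* _ _)) (-‿distribˡ-* _ _) ⟩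
      - y · linComb (cs ∘ Fin.suc) (w ∘ Fin.suc) i    ≈⟨ linComb-scale (- y) (cs ∘ Fin.suc) (w ∘ Fin.suc) i ⟨
      linComb (λ t → - y · cs (Fin.suc t)) (w ∘ Fin.suc) i ∎
      where
      y = proj₁ (inverse (cs Fin.zero) cs₀≉0)
      cs₀y≈1 = proj₂ (inverse (cs Fin.zero) cs₀≉0)

  -- Gaussian elimination of coordinate q from x₁ … xₛ against the pivot x₀ q.
  module Elimination {r s} (x : Fin (suc s) → Vector Carrier (suc r))
                     (q : Fin (suc r)) (pivot : x Fin.zero q ≉ 0#) where
    x₀ = x Fin.zero
    y = proj₁ (inverse (x₀ q) pivot)

    factor : Fin s → Carrier
    factor u = x (Fin.suc u) q · y

    cleared : Fin s → Vector Carrier (suc r)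
    cleared u i = x (Fin.suc u) i - factor u · x₀ i

    cleared-pivot : ∀ u → cleared u q ≈ 0#
    cleared-pivot u = begin
      x (Fin.suc u) q - (x (Fin.suc u) q · y) · x₀ q
        ≈⟨ +-congˡ (-‿cong (trans (*-assoc _ _ _) (*-congˡ (*-comm y (x₀ q))))) ⟩
      x (Fin.suc u) q - x (Fin.suc u) q · (x₀ q · y)
        ≈⟨ +-congˡ (-‿cong (trans (*-congˡ (proj₂ (inverse (x₀ q) pivot))) (*-identityʳ _))) ⟩
      x (Fin.suc u) q - x (Fin.suc u) q
        ≈⟨ -‿inverseʳ _ ⟩
      0# ∎

    reduced : Fin s → Vector Carrier r
    reduced u = cleared u ∘ punchIn q

    lift : Dependent reduced → Dependent x
    lift (d , (u₀ , d-u₀≉0) , rel) = (- sum (λ u → d u · factor u)) ∷ d , (Fin.suc u₀ , d-u₀≉0) , λ i → begin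
      - Σdf · x₀ i + linComb d (x ∘ Fin.suc) i   ≈⟨ +-comm _ _ ⟩
      linComb d (x ∘ Fin.suc) i + - Σdf · x₀ i   ≈⟨ +-congˡ (sym (-‿distribˡ-* _ _)) ⟩
      linComb d (x ∘ Fin.suc) i - Σdf · x₀ i     ≈⟨ linComb-sub-multiple d factor (x ∘ Fin.suc) x₀ i ⟨
      linComb d cleared i                         ≈⟨ linComb-cleared i ⟩
      0#                                          ∎
      where
      Σdf = sum (λ u → d u · factor u)
      linComb-cleared : ∀ i → linComb d cleared i ≈ 0#
      linComb-cleared i with q Fin.≟ i
      ... | yes ≡.refl = sum-zero (λ u → trans (*-congˡ (cleared-pivot u)) (zeroʳ _))
      ... | no  q≢i    = ≡.subst (λ j → linComb d cleared j ≈ 0#) (Fin.punchIn-punchOut q≢i) (rel (punchOut q≢i))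

  dependent-if-longer : ∀ {r s} → r < s → (x : Fin s → Vector Carrier r) → ¬ ¬ Dependent x
  dependent-if-longer {zero}  {suc s} _         x = return (const 1# , (Fin.zero , 1≉0) , λ ())
  dependent-if-longer {suc r} {suc s} (s≤s r<s) x = do
    yes (q , pivot) ← ¬¬-excluded-middle {A = ∃ λ q → x Fin.zero q ≉ 0#}
      where no no-pivot → ¬¬-map (dependent-of-zero x Fin.zero) (¬¬-∀-Fin _ (λ q x₀q≉0 → no-pivot (q , x₀q≉0)))
    ¬¬-map (Elimination.lift x q pivot) (dependent-if-longer r<s (Elimination.reduced x q pivot))

  linComb-image : ∀ {s r m} cs (U : Matrix m r) (x : Fin s → Vector Carrier r) i →
                  linComb cs (λ t i → sum (λ k → U i k · x t k)) i ≈ sum (λ k → U i k · linComb cs x k)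
  linComb-image {s} {r} cs U x i = begin
    sum (λ t → cs t · sum (λ k → U i k · x t k))
      ≈⟨ sum-cong-≋ (λ t → *-distribˡ-sum (cs t) (λ k → U i k · x t k)) ⟩
    sum (λ t → sum (λ k → cs t · (U i k · x t k)))
      ≈⟨ ∑-comm {s} {r} (λ t k → cs t · (U i k · x t k)) ⟩
    sum (λ k → sum (λ t → cs t · (U i k · x t k)))
      ≈⟨ sum-cong-≋ (λ k → sum-cong-≋ (λ t → x·[y·z]≈y·[x·z] (cs t) (U i k) (x t k))) ⟩
    sum (λ k → sum (λ t → U i k · (cs t · x t k)))
      ≈⟨ sum-cong-≋ (λ k → *-distribˡ-sum (U i k) (λ t → cs t · x t k)) ⟨
    sum (λ k → U i k · linComb cs x k)
      ∎
    where
    x·[y·z]≈y·[x·z] : ∀ a b e → a · (b · e) ≈ b · (a · e)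
    x·[y·z]≈y·[x·z] a b e = trans (sym (*-assoc a b e)) (trans (*-congʳ (*-comm a b)) (*-assoc b a e))

  dependent-image : ∀ {s r m} (U : Matrix m r) {x : Fin s → Vector Carrier r} {w : Fin s → Vector Carrier m} →
                    (∀ t i → w t i ≈ sum (λ k → U i k · x t k)) → Dependent x → Dependent w
  dependent-image U {x} {w} w≈Ux (cs , cs≉0 , rel) = cs , cs≉0 , λ i → begin
    linComb cs w i                                  ≈⟨ sum-cong-≋ (λ t → *-congˡ (w≈Ux t i)) ⟩
    linComb cs (λ t i → sum (λ k → U i k · x t k)) i ≈⟨ linComb-image cs U x i ⟩
    sum (λ k → U i k · linComb cs x k)              ≈⟨ sum-zero (λ k → trans (*-congˡ (rel k)) (zeroʳ _)) ⟩
    0#                                              ∎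

  columns : ∀ {m n} → Matrix m n → Fin n → Vector Carrier m
  columns N j i = N i j

  IndependentSubfamily : ∀ {n m} → (Fin n → Vector Carrier m) → ℕ → Set (c ⊔ ℓ)
  IndependentSubfamily {n} w b = Σ[ js ∈ (Fin b → Fin n) ] Independent (w ∘ js)

  BasisBelow : ∀ {n m} → (Fin n → Vector Carrier m) → ℕ → Set (c ⊔ ℓ)
  BasisBelow {n} w b = ∃ λ s → s < b ×
    Σ[ js ∈ (Fin s → Fin n) ] Independent (w ∘ js) × (∀ j → InSpan (w ∘ js) (w j))

  empty-subfamily : ∀ {n m} (w : Fin n → Vector Carrier m) → IndependentSubfamily w 0
  empty-subfamily w = (λ ()) , λ { (_ , (() , _) , _) }

  independentSubfamily-or-basisBelow : ∀ {n m} b (w : Fin n → Vector Carrier m) →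
                                       ¬ ¬ (IndependentSubfamily w b ⊎ BasisBelow w b)
  independentSubfamily-or-basisBelow {zero} zero    w = return (inj₁ (empty-subfamily w))
  independentSubfamily-or-basisBelow {zero} (suc b) w =
    let js , ind = empty-subfamily w in return (inj₂ (0 , s≤s z≤n , js , ind , λ ()))
  independentSubfamily-or-basisBelow {suc n} b w = do
    inj₂ (s , s<b , js , ind , spans) ← independentSubfamily-or-basisBelow b (w ∘ Fin.suc)
      where inj₁ (js , ind) → return (inj₁ (Fin.suc ∘ js , ind))
    yes w₀∈span ← ¬¬-excluded-middle {A = InSpan (w ∘ Fin.suc ∘ js) (w Fin.zero)}
      where no w₀∉span → return (extend s<b js ind w₀∉span spans)
    return (inj₂ (s , s<b , Fin.suc ∘ js , ind , λ { Fin.zero → w₀∈span ; (Fin.suc j) → spans j }))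
    where
    extend : ∀ {s} → s < b → (js : Fin s → Fin n) → Independent (w ∘ Fin.suc ∘ js) →
             ¬ InSpan (w ∘ Fin.suc ∘ js) (w Fin.zero) → (∀ j → InSpan (w ∘ Fin.suc ∘ js) (w (Fin.suc j))) →
             IndependentSubfamily w b ⊎ BasisBelow w b
    extend {s} s<b js ind w₀∉span spans = grow (ℕ.m≤n⇒m<n∨m≡n s<b)
      where
      js′ = Fin.zero ∷ Fin.suc ∘ js
      ind′ = independent-∷ (w ∘ js′) ind w₀∉span
      spans′ : ∀ j → InSpan (w ∘ js′) (w j)
      spans′ Fin.zero    = inSpan-member (w ∘ js′) Fin.zero
      spans′ (Fin.suc j) = inSpan-∷ (w ∘ js′) (spans j)
      grow : suc s < b ⊎ suc s ≡ b → IndependentSubfamily w b ⊎ BasisBelow w b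
      grow (inj₁ 1+s<b) = inj₂ (suc s , 1+s<b , js′ , ind′ , spans′)
      grow (inj₂ 1+s≡b) = inj₁ (≡.subst (IndependentSubfamily w) 1+s≡b (js′ , ind′))

  basis⇒RankLE : ∀ {m n s} (N : Matrix m n) (js : Fin s → Fin n) →
                 (∀ j → InSpan (columns N ∘ js) (columns N j)) → RankLE N s
  basis⇒RankLE {s = s} N js spans = (λ i k → N i (js k)) , (λ k j → proj₁ (spans j) k) , λ i j → begin
    N i j                                        ≈⟨ proj₂ (spans j) i ⟩
    sum (λ k → proj₁ (spans j) k · N i (js k))   ≈⟨ sum-cong-≋ (λ k → *-comm _ (N i (js k))) ⟩
    sum (λ k → N i (js k) · proj₁ (spans j) k)   ≡⟨ ∑≡sum s _ ⟨
    ∑ s (λ k → N i (js k) · proj₁ (spans j) k)   ∎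

  minRank⇒independentColumns : ∀ {p m n} {S : Matrix m n → Set p} {k N} → IsMinRank S k → S N → NonZero N →
                               ¬ ¬ IndependentSubfamily (columns N) k
  minRank⇒independentColumns {k = k} {N} (_ , minimal) N∈S N≉0 = do
    inj₂ (s , s<k , js , _ , spans) ← independentSubfamily-or-basisBelow k (columns N)
      where inj₁ found → return found
    contradiction (minimal N N∈S N≉0 s (basis⇒RankLE N js spans)) (ℕ.<⇒≱ s<k)

  independentColumns⇒≤rank : ∀ {m n r s} {M : Matrix m n} → RankLE M r →
                             (js : Fin s → Fin n) → Independent (columns M ∘ js) → s ≤ r
  independentColumns⇒≤rank {r = r} {s} (U , V , M≈UV) js ind = decidable-stable (s ℕ.≤? r) λ s≰r →
    dependent-if-longer (ℕ.≰⇒> s≰r) (columns V ∘ js)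
      (ind ∘ dependent-image U (λ t i → trans (M≈UV i (js t)) (reflexive (∑≡sum r (λ k → U i k · V k (js t))))))

  -- The family is indexed by p = combine t u (column u of block t); ρ t selects the rows of block t.
  independent-blockDiagonal :
    ∀ {a b m m′} (w : Fin a → Fin b → Vector Carrier m) (ρ : Fin a → Fin m′ → Fin m) →
    (∀ {t t′} → t′ ≢ t → ∀ u k → w t′ u (ρ t k) ≈ 0#) →
    (∀ t → Independent (λ u → w t u ∘ ρ t)) →
    Independent (λ p → w (quotient {a} b p) (remainder {a} b p))
  independent-blockDiagonal {a} {b} w ρ offBlock≈0 blocks-ind (cs , (p₀ , cs-p₀≉0) , rel) =
    blocks-ind t₀ (cs ∘ combine t₀ , (u₀ , cs-t₀u₀≉0) , λ k → begin
      linComb (cs ∘ combine t₀) (λ u → w t₀ u ∘ ρ t₀) k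
        ≈⟨ sum-single {a} (λ t → sum {b} (λ u → cs (combine t u) · w t u (ρ t₀ k))) t₀
             (λ t t≢t₀ → sum-zero (λ u → trans (*-congˡ (offBlock≈0 t≢t₀ u k)) (zeroʳ _))) ⟨
      sum {a} (λ t → sum {b} (λ u → cs (combine t u) · w t u (ρ t₀ k)))
        ≡⟨ sum-cong-≗ {a} (λ t → sum-cong-≗ {b} (λ u →
             ≡.cong (λ tu → cs (combine t u) · w (proj₁ tu) (proj₂ tu) (ρ t₀ k)) (Fin.remQuot-combine t u))) ⟨
      sum {a} (λ t → sum {b} (λ u →
        cs (combine t u) · w (quotient {a} b (combine t u)) (remainder {a} b (combine t u)) (ρ t₀ k)))
        ≈⟨ sum-combine a b (λ p → cs p · w (quotient {a} b p) (remainder {a} b p) (ρ t₀ k)) ⟨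
      linComb cs (λ p → w (quotient {a} b p) (remainder {a} b p)) (ρ t₀ k)
        ≈⟨ rel (ρ t₀ k) ⟩
      0# ∎)
    where
    t₀ = quotient b p₀
    u₀ = remainder {a} b p₀
    cs-t₀u₀≉0 : cs (combine t₀ u₀) ≉ 0#
    cs-t₀u₀≉0 = ≡.subst (λ p → cs p ≉ 0#) (≡.sym (Fin.combine-remQuot {a} b p₀)) cs-p₀≉0

  sum-∈ : ∀ {p m n} {S : Matrix m n → Set p} → IsSubspace S →
          ∀ {K} (x : Vector Carrier K) (Ms : Fin K → Matrix m n) → (∀ t → S (Ms t)) →
          S (λ i j → sum (λ t → x t · Ms t i j))
  sum-∈ S-sub {zero}  x Ms Ms∈S = IsSubspace.zero∈ S-sub
  sum-∈ S-sub {suc K} x Ms Ms∈S = IsSubspace.+∈ S-sub (IsSubspace.·∈ S-sub (x Fin.zero) (Ms∈S Fin.zero))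
                                    (sum-∈ S-sub (x ∘ Fin.suc) (Ms ∘ Fin.suc) (Ms∈S ∘ Fin.suc))

  kron-combine : ∀ {n₁ n₂ m₁ m₂} (A : Matrix n₁ n₂) (B : Matrix m₁ m₂) i k j l →
                 kron A B (combine i k) (combine j l) ≡ A i j · B k l
  kron-combine {m₁ = m₁} {m₂} A B i k j l =
    ≡.cong₂ (λ (i′ , k′) (j′ , l′) → A i′ j′ · B k′ l′)
      (Fin.remQuot-combine {k = m₁} i k) (Fin.remQuot-combine {k = m₂} j l)

  module _ {n₁ n₂ m₁ m₂ : ℕ} where

    block : Matrix (n₁ * m₁) (n₂ * m₂) → Fin n₁ → Fin n₂ → Matrix m₁ m₂
    block M i j k l = M (combine i k) (combine j l)

    slice : Matrix (n₁ * m₁) (n₂ * m₂) → Fin m₁ → Fin m₂ → Matrix n₁ n₂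
    slice M k l i j = M (combine i k) (combine j l)

    entry-combine : ∀ {M : Matrix (n₁ * m₁) (n₂ * m₂)} {K} {cs : Vector Carrier K}
                      {As : Fin K → Matrix n₁ n₂} {Bs : Fin K → Matrix m₁ m₂} →
                    (∀ r s → M r s ≈ ∑ K (λ t → cs t · kron (As t) (Bs t) r s)) →
                    ∀ i k j l → M (combine i k) (combine j l) ≈ sum (λ t → cs t · (As t i j · Bs t k l))
    entry-combine {M} {K} {cs} {As} {Bs} M≈ i k j l = begin
      M (combine i k) (combine j l)
        ≈⟨ M≈ _ _ ⟩
      ∑ K (λ t → cs t · kron (As t) (Bs t) (combine i k) (combine j l))
        ≡⟨ ∑≡sum K _ ⟩
      sum (λ t → cs t · kron (As t) (Bs t) (combine i k) (combine j l))
        ≡⟨ sum-cong-≗ (λ t → ≡.cong (cs t ·_) (kron-combine (As t) (Bs t) i k j l)) ⟩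
      sum (λ t → cs t · (As t i j · Bs t k l))
        ∎

    module _ {p q} {𝒜 : Matrix n₁ n₂ → Set p} {ℬ : Matrix m₁ m₂ → Set q} where

      block-∈ : IsSubspace ℬ → ∀ {M} → (𝒜 ⊗ˢ ℬ) M → ∀ i j → ℬ (block M i j)
      block-∈ ℬ-sub (K , cs , As , Bs , _ , Bs∈ℬ , M≈) i j =
        IsSubspace.resp ℬ-sub (λ k l → sym (trans (entry-combine {cs = cs} {As} {Bs} M≈ i k j l)
                                              (sum-cong-≋ (λ t → sym (*-assoc (cs t) (As t i j) (Bs t k l))))))
          (sum-∈ ℬ-sub (λ t → cs t · As t i j) Bs Bs∈ℬ)

      slice-∈ : IsSubspace 𝒜 → ∀ {M} → (𝒜 ⊗ˢ ℬ) M → ∀ k l → 𝒜 (slice M k l)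
      slice-∈ 𝒜-sub (K , cs , As , Bs , As∈𝒜 , _ , M≈) k l =
        IsSubspace.resp 𝒜-sub (λ i j → sym (trans (entry-combine {cs = cs} {As} {Bs} M≈ i k j l)
                                              (sum-cong-≋ (λ t → trans (*-congˡ (*-comm (As t i j) (Bs t k l)))
                                                                       (sym (*-assoc (cs t) (Bs t k l) (As t i j)))))))
          (sum-∈ 𝒜-sub (λ t → cs t · Bs t k l) As As∈𝒜)

  nonzero-entry : ∀ {m n} {M : Matrix m n} → NonZero M → ¬ ¬ ∃₂ λ i j → M i j ≉ 0#
  nonzero-entry {m} {n} M≉0 = do
    (i , row≉0) ← ¬∀⇒¬¬∃¬ m M≉0
    (j , Mij≉0) ← ¬∀⇒¬¬∃¬ n row≉0
    return (i , j , Mij≉0)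

  diagonal-support : ∀ {m n} {A : Matrix m n} → Diagonal A → ∀ {i j} → A i j ≉ 0# → toℕ i ≡ toℕ j
  diagonal-support A-diag {i} {j} Aij≉0 = decidable-stable (toℕ i ℕ.≟ toℕ j) (Aij≉0 ∘ A-diag i j)

  diagonal-pivots-distinct : ∀ {m n s} {A : Matrix m n} → Diagonal A →
    (js : Fin s → Fin n) → Independent (columns A ∘ js) → (is : Fin s → Fin m) → (∀ t → A (is t) (js t) ≉ 0#) →
    ∀ {t t′} → toℕ (is t) ≡ toℕ (js t′) → t ≡ t′
  diagonal-pivots-distinct {A = A} A-diag js js-ind is pivot≉0 {t} {t′} is-t≡js-t′ =
    independent⇒injective js-ind (λ i → reflexive (≡.cong (A i) js-t≡js-t′))
    where
    js-t≡js-t′ : js t ≡ js t′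
    js-t≡js-t′ = Fin.toℕ-injective (≡.trans (≡.sym (diagonal-support A-diag (pivot≉0 t))) is-t≡js-t′)

  module TensorColumns {p q n₁ n₂ m₁ m₂} {𝒜 : Matrix n₁ n₂ → Set p} {ℬ : Matrix m₁ m₂ → Set q}
    (𝒜-sub : IsSubspace 𝒜) (ℬ-sub : IsSubspace ℬ) (𝒜-diag : ∀ A → 𝒜 A → Diagonal A)
    {a b} (𝒜-min : IsMinRank 𝒜 a) (ℬ-min : IsMinRank ℬ b) {M} (M∈𝒜⊗ℬ : (𝒜 ⊗ˢ ℬ) M) where

    slice-diagonal : ∀ k l → Diagonal (slice M k l)
    slice-diagonal k l = 𝒜-diag _ (slice-∈ {ℬ = ℬ} 𝒜-sub M∈𝒜⊗ℬ k l)

    independentColumns-from-slice : ∀ k l → NonZero (slice M k l) → ¬ ¬ IndependentSubfamily (columns M) (a * b)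
    independentColumns-from-slice k l slice≉0 = do
      (js , js-ind) ← minRank⇒independentColumns 𝒜-min (slice-∈ {ℬ = ℬ} 𝒜-sub M∈𝒜⊗ℬ k l) slice≉0
      pivots ← ¬¬-∀-Fin a (λ t → ¬∀⇒¬¬∃¬ n₁ (independent⇒nonzero js-ind t))
      let is = proj₁ ∘ pivots
      blockColumns ← ¬¬-∀-Fin a (λ t →
        minRank⇒independentColumns ℬ-min (block-∈ {𝒜 = 𝒜} ℬ-sub M∈𝒜⊗ℬ (is t) (js t))
                                         (λ block≈0 → proj₂ (pivots t) (block≈0 k l)))
      -- for t′ ≢ t the block (is t , js t′) lies off the diagonal of every slice
      return (_ , independent-blockDiagonal
        (λ t u R → M R (combine (js t) (proj₁ (blockColumns t) u))) (λ t k′ → combine (is t) k′)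
        (λ t′≢t u k′ → slice-diagonal k′ _ (is _) (js _)
          (t′≢t ∘ ≡.sym ∘ diagonal-pivots-distinct (slice-diagonal k l) js js-ind is (proj₂ ∘ pivots)))
        (proj₂ ∘ blockColumns))

    independentColumns : NonZero M → ¬ ¬ IndependentSubfamily (columns M) (a * b)
    independentColumns M≉0 = do
      (R , S , M-RS≉0) ← nonzero-entry M≉0
      independentColumns-from-slice (remainder {n₁} m₁ R) (remainder {n₂} m₂ S) λ slice≈0 →
        M-RS≉0 (≡.subst₂ (λ R′ S′ → M R′ S′ ≈ 0#)
                         (Fin.combine-remQuot {n₁} m₁ R) (Fin.combine-remQuot {n₂} m₂ S)
                         (slice≈0 (quotient {n₁} m₁ R) (quotient {n₂} m₂ S)))

lemma3p13 : ∀ {c ℓ p q : Level} (F : Field c ℓ) → let open FieldDefs F in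
    ∀ {n₁ n₂ m₁ m₂ : ℕ} (𝒜 : Matrix n₁ n₂ → Set p) (ℬ : Matrix m₁ m₂ → Set q) →
    IsSubspace 𝒜 → IsSubspace ℬ → (∀ A → 𝒜 A → Diagonal A) →
    ∀ a b → IsMinRank 𝒜 a → IsMinRank ℬ b →
    ∀ M → (𝒜 ⊗ˢ ℬ) M → NonZero M → ∀ r → RankLE M r → a * b ≤ r
lemma3p13 F 𝒜 ℬ 𝒜-sub ℬ-sub 𝒜-diag a b 𝒜-min ℬ-min M M∈𝒜⊗ℬ M≉0 r rank≤r =
  decidable-stable (a * b ℕ.≤? r) (¬¬-map
    (λ (cols , cols-ind) → independentColumns⇒≤rank rank≤r cols cols-ind)
    (independentColumns M≉0))
  where
  open MatrixSpaces F
  open TensorColumns 𝒜-sub ℬ-sub 𝒜-diag 𝒜-min ℬ-min M∈𝒜⊗ℬ
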